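{- Let $A$ be an MV-algebra and $x$ a prime lattice ideal point with ideal $I_x$ and complementary prime filter $F_x=A\setminus I_x$. Then (i) there is a largest lattice ideal $J$ of $A$ such that $I_x\,\overline{\oplus}\,J\subseteq I_x$, namely the prime lattice ideal $A\setminus(F_x\,\overline{\ominus}\,I_x)$; and (ii) this ideal $A\setminus(F_x\,\overline{\ominus}\,I_x)$ is a prime MV-ideal.
   Context: MV-algebra $(A,\oplus,\neg,0)$: $(A,\oplus,0)$ commutative monoid, $\neg\neg x=x$, $x\oplus\neg0=\neg0$, $\neg(\neg x\oplus y)\oplus y=\neg(\neg y\oplus x)\oplus x$; $x\ominus y:=\neg(\neg x\oplus y)$; lattice operations $x\vee y:=\neg(\neg x\oplus y)\oplus y$, $x\wedge y:=\neg(\neg x\vee\neg y)$. MV-ideal: downset containing $0$ closed under $\oplus$; prime if proper and for all $a,b$, $a\ominus b$ or $b\ominus a$ lies in it. $I_x$ is a prime ideal of the lattice reduct of $A$. For lattice ideals $I,J$: $I\,\overline{\oplus}\,J:=\{c\in A:\exists a\in I,b\in J,\ c\le a\oplus b\}$. For a lattice filter $F$ and lattice ideal $I$: $F\,\overline{\ominus}\,I:=\{c\in A:\exists a\in F,b\in I,\ c\ge a\ominus b\}$. -}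

module Defs where

open import Data.Product using (Σ; ∃; _×_; _,_)
open import Data.Sum using (_⊎_)
open import Relation.Nullary using (¬_; Dec)
open import Relation.Binary.PropositionalEquality using (_≡_)

record MVAlgebra : Set₁ where
  infixl 6 _⊕_
  field
    Carrier : Set
    _⊕_     : Carrier → Carrier → Carrier
    neg     : Carrier → Carrier
    zero    : Carrier
    ⊕-assoc    : ∀ x y z → (x ⊕ y) ⊕ z ≡ x ⊕ (y ⊕ z)
    ⊕-comm     : ∀ x y → x ⊕ y ≡ y ⊕ x
    ⊕-identity : ∀ x → x ⊕ zero ≡ x
    neg-invol  : ∀ x → neg (neg x) ≡ x
    ⊕-absorb   : ∀ x → x ⊕ neg zero ≡ neg zero
    luk        : ∀ x y → neg (neg x ⊕ y) ⊕ y ≡ neg (neg y ⊕ x) ⊕ x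

  one : Carrier
  one = neg zero

  infixl 6 _⊖_
  _⊖_ : Carrier → Carrier → Carrier
  x ⊖ y = neg (neg x ⊕ y)

  _∨_ : Carrier → Carrier → Carrier
  x ∨ y = neg (neg x ⊕ y) ⊕ y

  _∧_ : Carrier → Carrier → Carrier
  x ∧ y = neg (neg x ∨ neg y)

  -- the natural order of the MV-algebra (= the lattice order of the reduct)
  infix 4 _≤_
  _≤_ : Carrier → Carrier → Set
  x ≤ y = neg x ⊕ y ≡ one

  Subset : Set₁
  Subset = Carrier → Set

  _⊆_ : Subset → Subset → Set
  S ⊆ T = ∀ x → S x → T x

  ∁ : Subset → Subset
  ∁ S x = ¬ S x

  Proper : Subset → Set
  Proper S = ∃ λ x → ¬ S x

  record IsLatticeIdeal (I : Subset) : Set where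
    field
      nonempty : ∃ λ x → I x
      downward : ∀ {x y} → x ≤ y → I y → I x
      ∨-closed : ∀ {x y} → I x → I y → I (x ∨ y)

  record IsPrimeLatticeIdeal (I : Subset) : Set where
    field
      isLatticeIdeal : IsLatticeIdeal I
      proper         : Proper I
      prime          : ∀ {x y} → I (x ∧ y) → I x ⊎ I y

  record IsLatticeFilter (F : Subset) : Set where
    field
      nonempty : ∃ λ x → F x
      upward   : ∀ {x y} → x ≤ y → F x → F y
      ∧-closed : ∀ {x y} → F x → F y → F (x ∧ y)

  record IsMVIdeal (I : Subset) : Set where
    field
      zero∈    : I zero
      downward : ∀ {x y} → x ≤ y → I y → I x
      ⊕-closed : ∀ {x y} → I x → I y → I (x ⊕ y)

  record IsPrimeMVIdeal (I : Subset) : Set where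
    field
      isMVIdeal : IsMVIdeal I
      proper    : Proper I
      prime     : ∀ a b → I (a ⊖ b) ⊎ I (b ⊖ a)

  _⊕̄_ : Subset → Subset → Subset
  (I ⊕̄ J) c = Σ Carrier λ a → Σ Carrier λ b → I a × J b × c ≤ a ⊕ b

  _⊖̄_ : Subset → Subset → Subset
  (F ⊖̄ I) c = Σ Carrier λ a → Σ Carrier λ b → F a × I b × a ⊖ b ≤ c

ExcludedMiddle : Set₁
ExcludedMiddle = (P : Set) → Dec P

-- K := A ∖ (F_x ⊖̄ I_x) is, classically, the set of c with I_x ⊕ c ⊆ I_x; this makes it an
-- MV-ideal and the largest lattice ideal J with I_x ⊕̄ J ⊆ I_x. It is prime because
-- (a ⊖ b) ∧ (b ⊖ a) = 0: were both a ⊖ b and b ⊖ a outside K, witnessed by b₁, b₂ ∈ I_x, then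
-- with b = b₁ ∨ b₂ the meet (b ⊕ (a ⊖ b)) ∧ (b ⊕ (b ⊖ a)) lies below b ∈ I_x, contradicting
-- primeness of I_x.
module Submission where

open import Defs
open import Data.Product using (_×_; Σ; _,_; proj₂)
open import Data.Sum as Sum using (_⊎_; inj₁; inj₂)
open import Data.Empty using (⊥-elim)
open import Relation.Nullary using (¬_; yes; no)
open import Relation.Binary.PropositionalEquality using (_≡_; sym; trans; cong; subst)

module MVProperties (A : MVAlgebra) where
  open MVAlgebra A

  neg-one-identityˡ : ∀ x → neg one ⊕ x ≡ x
  neg-one-identityˡ x = sym (trans (sym (neg-invol x)) (trans (cong neg (sym (⊕-identity (neg x))))
    (trans (sym (⊕-identity _)) (trans (luk x zero)
      (cong (λ z → neg z ⊕ x) (trans (⊕-comm _ x) (⊕-absorb x)))))))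

  ⊕-inverseˡ : ∀ x → neg x ⊕ x ≡ one
  ⊕-inverseˡ x = sym (trans (sym (⊕-absorb _))
    (trans (luk x one) (cong (λ z → neg z ⊕ x) (neg-one-identityˡ x))))

  ⊕-inverseʳ : ∀ x → x ⊕ neg x ≡ one
  ⊕-inverseʳ x = trans (⊕-comm _ _) (⊕-inverseˡ x)

  ⊕-oneˡ : ∀ x → one ⊕ x ≡ one
  ⊕-oneˡ x = trans (⊕-comm _ _) (⊕-absorb x)

  ≤-refl : ∀ {x} → x ≤ x
  ≤-refl {x} = ⊕-inverseˡ x

  ≤-one : ∀ x → x ≤ one
  ≤-one x = ⊕-absorb (neg x)

  ≡⊕⇒≤ : ∀ {x y} w → y ≡ x ⊕ w → x ≤ y
  ≡⊕⇒≤ {x} w y≡x⊕w = trans (cong (neg x ⊕_) y≡x⊕w) (trans (sym (⊕-assoc _ _ _))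
    (trans (cong (_⊕ w) (⊕-inverseˡ x)) (⊕-oneˡ w)))

  ≤⇒≡⊕⊖ : ∀ {x y} → x ≤ y → y ≡ x ⊕ (y ⊖ x)
  ≤⇒≡⊕⊖ {x} {y} x≤y = sym (trans (⊕-comm _ _) (trans (luk y x)
    (trans (cong (λ z → neg z ⊕ y) x≤y) (neg-one-identityˡ y))))

  ≤⇒∨≡ʳ : ∀ {x y} → x ≤ y → x ∨ y ≡ y
  ≤⇒∨≡ʳ {y = y} x≤y = trans (cong (λ z → neg z ⊕ y) x≤y) (neg-one-identityˡ y)

  ≤-trans : ∀ {x y z} → x ≤ y → y ≤ z → x ≤ z
  ≤-trans {x} {y} {z} x≤y y≤z = ≡⊕⇒≤ ((y ⊖ x) ⊕ (z ⊖ y))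
    (trans (≤⇒≡⊕⊖ y≤z) (trans (cong (_⊕ (z ⊖ y)) (≤⇒≡⊕⊖ x≤y)) (⊕-assoc _ _ _)))

  ⊕-monoˡ-≤ : ∀ {x y} c → x ≤ y → x ⊕ c ≤ y ⊕ c
  ⊕-monoˡ-≤ {x} {y} c x≤y = ≡⊕⇒≤ (y ⊖ x)
    (trans (cong (_⊕ c) (≤⇒≡⊕⊖ x≤y)) (trans (⊕-assoc _ _ _)
      (trans (cong (x ⊕_) (⊕-comm _ _)) (sym (⊕-assoc _ _ _)))))

  ⊕-monoʳ-≤ : ∀ {x y} c → x ≤ y → c ⊕ x ≤ c ⊕ y
  ⊕-monoʳ-≤ {x} {y} c x≤y =
    subst (_≤ c ⊕ y) (⊕-comm x c) (subst (x ⊕ c ≤_) (⊕-comm y c) (⊕-monoˡ-≤ c x≤y))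

  neg-antitone : ∀ {x y} → x ≤ y → neg y ≤ neg x
  neg-antitone {x} {y} x≤y = trans (cong (_⊕ neg x) (neg-invol y)) (trans (⊕-comm _ _) x≤y)

  ≤⊕⇒⊖≤ : ∀ {t b w} → t ≤ b ⊕ w → t ⊖ b ≤ w
  ≤⊕⇒⊖≤ {w = w} t≤b⊕w = trans (cong (_⊕ w) (neg-invol _)) (trans (⊕-assoc _ _ _) t≤b⊕w)

  ⊖≤⇒≤⊕ : ∀ {t b w} → t ⊖ b ≤ w → t ≤ b ⊕ w
  ⊖≤⇒≤⊕ {w = w} t⊖b≤w = trans (sym (⊕-assoc _ _ _)) (trans (cong (_⊕ w) (sym (neg-invol _))) t⊖b≤w)

  x⊖y≤x : ∀ {x y} → x ⊖ y ≤ x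
  x⊖y≤x {x} {y} = ≤⊕⇒⊖≤ (≡⊕⇒≤ y (⊕-comm y x))

  x⊖y≤negy : ∀ {x y} → x ⊖ y ≤ neg y
  x⊖y≤negy {x} {y} = trans (cong (_⊕ neg y) (neg-invol _)) (trans (⊕-assoc _ _ _)
    (trans (cong (neg x ⊕_) (⊕-inverseʳ y)) (⊕-absorb (neg x))))

  ⊖-monoˡ-≤ : ∀ {x z} y → x ≤ z → x ⊖ y ≤ z ⊖ y
  ⊖-monoˡ-≤ y x≤z = neg-antitone (⊕-monoˡ-≤ y (neg-antitone x≤z))

  y≤x∨y : ∀ {x y} → y ≤ x ∨ y
  y≤x∨y {x} {y} = ≡⊕⇒≤ (x ⊖ y) (⊕-comm _ _)

  x≤x∨y : ∀ {x y} → x ≤ x ∨ y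
  x≤x∨y {x} {y} = subst (x ≤_) (sym (luk x y)) y≤x∨y

  ∨-least : ∀ {x y z} → x ≤ z → y ≤ z → x ∨ y ≤ z
  ∨-least {x} {y} {z} x≤z y≤z =
    subst (x ∨ y ≤_) (trans (luk z y) (≤⇒∨≡ʳ y≤z)) (⊕-monoˡ-≤ y (⊖-monoˡ-≤ y x≤z))

  x∧y≤x : ∀ {x y} → x ∧ y ≤ x
  x∧y≤x {x} {y} = subst (x ∧ y ≤_) (neg-invol x) (neg-antitone x≤x∨y)

  x∧y≤y : ∀ {x y} → x ∧ y ≤ y
  x∧y≤y {x} {y} = subst (x ∧ y ≤_) (neg-invol y) (neg-antitone y≤x∨y)

  ∧-greatest : ∀ {x y z} → x ≤ y → x ≤ z → x ≤ y ∧ z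
  ∧-greatest {x} {y} {z} x≤y x≤z =
    subst (_≤ y ∧ z) (neg-invol x) (neg-antitone (∨-least (neg-antitone x≤y) (neg-antitone x≤z)))

  ∧-comm : ∀ x y → x ∧ y ≡ y ∧ x
  ∧-comm x y = cong neg (luk (neg x) (neg y))

  ⊕∧⊕≤⊕∧ : ∀ {b u v} → (b ⊕ u) ∧ (b ⊕ v) ≤ b ⊕ (u ∧ v)
  ⊕∧⊕≤⊕∧ = ⊖≤⇒≤⊕ (∧-greatest (≤⊕⇒⊖≤ x∧y≤x) (≤⊕⇒⊖≤ x∧y≤y))

  ∧≡⊖⊖ : ∀ x y → x ∧ y ≡ y ⊖ (y ⊖ x)
  ∧≡⊖⊖ x y = cong neg (trans (cong (λ z → neg z ⊕ neg y)
    (trans (cong (_⊕ neg y) (neg-invol x)) (⊕-comm x (neg y)))) (⊕-comm _ _))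

  ∧⊕⊖≡ʳ : ∀ x y → (x ∧ y) ⊕ (y ⊖ x) ≡ y
  ∧⊕⊖≡ʳ x y = trans (cong (_⊕ (y ⊖ x)) (∧≡⊖⊖ x y)) (trans (luk y (y ⊖ x)) (≤⇒∨≡ʳ x⊖y≤x))

  ∧⊕⊖≡ˡ : ∀ x y → (x ∧ y) ⊕ (x ⊖ y) ≡ x
  ∧⊕⊖≡ˡ x y = trans (cong (_⊕ (x ⊖ y)) (∧-comm x y)) (∧⊕⊖≡ʳ y x)

  -- With c = x ∧ y and w = (x ⊖ y) ∧ (y ⊖ x): c ⊕ w lies below x and y, hence below c,
  -- and w ≤ neg c, so w = w ∧ neg c = (c ⊕ w) ⊖ c ≤ c ⊖ c = 0.
  ⊖∧⊖≤zero : ∀ x y → (x ⊖ y) ∧ (y ⊖ x) ≤ zero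
  ⊖∧⊖≤zero x y = ≤-trans w≤w∧negc (subst (_≤ zero) (sym w∧negc≡c⊕w⊖c) (≤-trans c⊕w⊖c≤c⊖c c⊖c≤zero))
    where
    c = x ∧ y
    w = (x ⊖ y) ∧ (y ⊖ x)
    c⊕w≤x : c ⊕ w ≤ x
    c⊕w≤x = subst (c ⊕ w ≤_) (∧⊕⊖≡ˡ x y) (⊕-monoʳ-≤ c x∧y≤x)
    c⊕w≤y : c ⊕ w ≤ y
    c⊕w≤y = subst (c ⊕ w ≤_) (∧⊕⊖≡ʳ x y) (⊕-monoʳ-≤ c x∧y≤y)
    c⊕w⊖c≤c⊖c : (c ⊕ w) ⊖ c ≤ c ⊖ c
    c⊕w⊖c≤c⊖c = ⊖-monoˡ-≤ c (∧-greatest c⊕w≤x c⊕w≤y)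
    c⊖c≤zero : c ⊖ c ≤ zero
    c⊖c≤zero = trans (⊕-identity _) (trans (neg-invol _) (⊕-inverseˡ c))
    w≤w∧negc : w ≤ w ∧ neg c
    w≤w∧negc = ∧-greatest ≤-refl (≤-trans x∧y≤x (≤-trans x⊖y≤negy (neg-antitone x∧y≤y)))
    w∧negc≡c⊕w⊖c : w ∧ neg c ≡ (c ⊕ w) ⊖ c
    w∧negc≡c⊕w⊖c = trans (∧≡⊖⊖ w (neg c)) (cong neg
      (trans (cong (_⊕ neg (neg (neg c) ⊕ w)) (neg-invol c))
        (trans (cong (λ z → c ⊕ neg (z ⊕ w)) (neg-invol c)) (⊕-comm _ _))))

module IdealProperties (A : MVAlgebra) where
  open MVAlgebra A
  open MVProperties A

  IsMVIdeal⇒IsLatticeIdeal : ∀ {K} → IsMVIdeal K → IsLatticeIdeal K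
  IsMVIdeal⇒IsLatticeIdeal isMVIdeal = record
    { nonempty = zero , zero∈
    ; downward = downward
    ; ∨-closed = λ Kx Ky → downward (⊕-monoˡ-≤ _ x⊖y≤x) (⊕-closed Kx Ky)
    }
    where open IsMVIdeal isMVIdeal

  IsMVIdeal⇒∧-prime : ∀ {K} → IsMVIdeal K → (∀ a b → K (a ⊖ b) ⊎ K (b ⊖ a)) →
                      ∀ {x y} → K (x ∧ y) → K x ⊎ K y
  IsMVIdeal⇒∧-prime {K} isMVIdeal prime {x} {y} Kx∧y =
    Sum.map (λ Kx⊖y → subst K (∧⊕⊖≡ˡ x y) (⊕-closed Kx∧y Kx⊖y))
            (λ Ky⊖x → subst K (∧⊕⊖≡ʳ x y) (⊕-closed Kx∧y Ky⊖x))
            (prime x y)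
    where open IsMVIdeal isMVIdeal

module Stabiliser (em : ExcludedMiddle) (A : MVAlgebra) {I : MVAlgebra.Subset A}
                  (isLatticeIdeal : MVAlgebra.IsLatticeIdeal A I) where
  open MVAlgebra A
  open MVProperties A
  open IsLatticeIdeal isLatticeIdeal renaming (downward to I-downward)

  K : Subset
  K = ∁ (∁ I ⊖̄ I)

  Stable : Carrier → Set
  Stable c = ∀ {b} → I b → I (b ⊕ c)

  stable⇒∈K : ∀ {c} → Stable c → K c
  stable⇒∈K stable (a , b , a∉I , Ib , a⊖b≤c) = a∉I (I-downward (⊖≤⇒≤⊕ a⊖b≤c) (stable Ib))

  ∈K⇒stable : ∀ {c} → K c → Stable c
  ∈K⇒stable {c} Kc {b} Ib with em (I (b ⊕ c))
  ... | yes Ib⊕c = Ib⊕c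
  ... | no  b⊕c∉I = ⊥-elim (Kc (b ⊕ c , b , b⊕c∉I , Ib , ≤⊕⇒⊖≤ ≤-refl))

  ∉K⇒unstable : ∀ {c} → ¬ K c → Σ Carrier λ b → I b × ¬ I (b ⊕ c)
  ∉K⇒unstable {c} c∉K with em ((∁ I ⊖̄ I) c)
  ... | yes (a , b , a∉I , Ib , a⊖b≤c) = b , Ib , λ Ib⊕c → a∉I (I-downward (⊖≤⇒≤⊕ a⊖b≤c) Ib⊕c)
  ... | no  ¬c∈F⊖̄I = ⊥-elim (c∉K ¬c∈F⊖̄I)

  isMVIdeal : IsMVIdeal K
  isMVIdeal = record
    { zero∈    = stable⇒∈K λ {b} Ib → subst I (sym (⊕-identity b)) Ib
    ; downward = λ x≤y Ky (a , b , a∉I , Ib , a⊖b≤x) → Ky (a , b , a∉I , Ib , ≤-trans a⊖b≤x x≤y)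
    ; ⊕-closed = λ {x} {y} Kx Ky → stable⇒∈K λ {b} Ib →
        subst I (⊕-assoc b x y) (∈K⇒stable Ky (∈K⇒stable Kx Ib))
    }

  I⊕̄K⊆I : (I ⊕̄ K) ⊆ I
  I⊕̄K⊆I c (a , b , Ia , Kb , c≤a⊕b) = I-downward c≤a⊕b (∈K⇒stable Kb Ia)

  K-largest : ∀ J → (I ⊕̄ J) ⊆ I → J ⊆ K
  K-largest J I⊕̄J⊆I c Jc = stable⇒∈K λ {b} Ib → I⊕̄J⊆I (b ⊕ c) (b , c , Ib , Jc , ≤-refl)

  K-proper : Proper I → Proper K
  K-proper (x , x∉I) = one , λ Kone →
    x∉I (I-downward (≤-one x) (subst I (⊕-absorb _) (∈K⇒stable Kone (proj₂ nonempty))))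

  K-prime : (∀ {x y} → I (x ∧ y) → I x ⊎ I y) → ∀ a b → K (a ⊖ b) ⊎ K (b ⊖ a)
  K-prime I-prime a b with em (K (a ⊖ b)) | em (K (b ⊖ a))
  ... | yes Ka⊖b | _         = inj₁ Ka⊖b
  ... | no  _    | yes Kb⊖a  = inj₂ Kb⊖a
  ... | no  a⊖b∉K | no b⊖a∉K with ∉K⇒unstable a⊖b∉K | ∉K⇒unstable b⊖a∉K
  ...   | b₁ , Ib₁ , ¬Ib₁⊕a⊖b | b₂ , Ib₂ , ¬Ib₂⊕b⊖a
          with I-prime (I-downward meet≤b (∨-closed Ib₁ Ib₂))
    where
    meet≤b : ((b₁ ∨ b₂) ⊕ (a ⊖ b)) ∧ ((b₁ ∨ b₂) ⊕ (b ⊖ a)) ≤ b₁ ∨ b₂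
    meet≤b = ≤-trans ⊕∧⊕≤⊕∧ (subst ((b₁ ∨ b₂) ⊕ ((a ⊖ b) ∧ (b ⊖ a)) ≤_) (⊕-identity _) (⊕-monoʳ-≤ _ (⊖∧⊖≤zero a b)))
  ... | inj₁ I⊕a⊖b = ⊥-elim (¬Ib₁⊕a⊖b (I-downward (⊕-monoˡ-≤ _ x≤x∨y) I⊕a⊖b))
  ... | inj₂ I⊕b⊖a = ⊥-elim (¬Ib₂⊕b⊖a (I-downward (⊕-monoˡ-≤ _ y≤x∨y) I⊕b⊖a))

proposition7p4 : ExcludedMiddle → (A : MVAlgebra) → (I : MVAlgebra.Subset A) →
    MVAlgebra.IsPrimeLatticeIdeal A I →
    let open MVAlgebra A
        F = ∁ I
        K = ∁ (F ⊖̄ I)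
    in (IsPrimeLatticeIdeal K
         × ((I ⊕̄ K) ⊆ I)
         × (∀ (J : Subset) → IsLatticeIdeal J → (I ⊕̄ J) ⊆ I → J ⊆ K))
       × IsPrimeMVIdeal K
proposition7p4 em A I isPrime =
  ( record { isLatticeIdeal = IsMVIdeal⇒IsLatticeIdeal isMVIdeal
           ; proper         = K-proper proper
           ; prime          = IsMVIdeal⇒∧-prime isMVIdeal K-prime′ }
  , I⊕̄K⊆I
  , λ J _ → K-largest J )
  , record { isMVIdeal = isMVIdeal ; proper = K-proper proper ; prime = K-prime′ }
  where
  open MVAlgebra A
  open IsPrimeLatticeIdeal isPrime
  open IdealProperties A
  open Stabiliser em A isLatticeIdeal
  K-prime′ : ∀ a b → K (a ⊖ b) ⊎ K (b ⊖ a)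
  K-prime′ = K-prime prime
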